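{- Let $d\ge0$ be an integer, let $S\subset[2]^\infty$ be a $d$-maximal set containing no $1$-ball, let $w\in S$, and let $k$ be an integer such that $S_k=\{a\in S:\mathrm{dist}(a,w)=k\}$ is nonempty. For $i\ge1$ let $p_i=\Pr_{a}[a_i\ne w_i]$, where $a$ is chosen uniformly at random from $S_k$. Then \[ \sum_i p_i=k\qquad\text{and}\qquad \sum_i p_i^2\ge k-d/2. \]
   Context: $[2]=\{1,2\}$, $[2]^\infty$ is the set of infinite sequences over $[2]$, $\mathrm{dist}(a,b)=|\{i:a_i\ne b_i\}|$, $\mathrm{diam}(S)=\sup_{a,b\in S}\mathrm{dist}(a,b)$. $S$ is $d$-maximal if $\mathrm{diam}(S)=d$ and $S$ is inclusion-maximal among subsets of $[2]^\infty$ of diameter $d$. $S$ contains a $1$-ball if $\{b:\mathrm{dist}(a,b)\le1\}\subset S$ for some $a$. (Such an $S$ is finite, so $S_k$ is finite.) -}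

module Defs where

open import Level using (0ℓ)
open import Data.Bool using (Bool)
open import Data.Bool.Properties using () renaming (_≟_ to _≟ᵇ_)
open import Data.Nat as ℕ using (ℕ; _≤_; _<_; NonZero)
open import Data.Integer using (+_)
open import Data.Rational using (ℚ; 0ℚ; _+_; _*_; _/_)
open import Data.List using (List; length; filter; map; upTo; foldr)
open import Data.List.Membership.Propositional using (_∈_)
open import Data.List.Relation.Unary.All using (All)
open import Data.List.Relation.Unary.Any using (Any)
open import Data.List.Relation.Unary.Unique.Propositional using (Unique)
open import Data.List.Relation.Unary.AllPairs using (AllPairs)
open import Data.Product using (Σ; ∃; ∃-syntax; _×_)
open import Function.Bundles using (_⇔_)
open import Relation.Nullary using (¬_; ¬?)
open import Relation.Binary.PropositionalEquality using (_≡_; _≢_)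

-- [2] = {1,2} is represented by Bool; [2]^∞ by functions ℕ → Bool
-- (coordinates indexed from 0 instead of 1).
Seq : Set
Seq = ℕ → Bool

SeqSet : Set₁
SeqSet = Seq → Set

_⊆_ : SeqSet → SeqSet → Set
S ⊆ T = ∀ a → S a → T a

_≈_ : Seq → Seq → Set
a ≈ b = ∀ i → a i ≡ b i

-- dist(a,b) = n : the set {i : a_i ≠ b_i} is finite of cardinality n,
-- i.e. it is enumerated by a duplicate-free list of length n.
Dist : Seq → Seq → ℕ → Set
Dist a b n = Σ (List ℕ) λ is →
  Unique is × length is ≡ n × (∀ i → (a i ≢ b i) ⇔ (i ∈ is))

DistLe : Seq → Seq → ℕ → Set
DistLe a b m = Σ ℕ λ n → Dist a b n × n ≤ m

-- diam(S) = d : all distances are ≤ d (finite) and the supremum d is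
-- attained (a supremum of a bounded set of naturals is a maximum).
Diam : SeqSet → ℕ → Set
Diam S d = (∀ a b → S a → S b → DistLe a b d)
         × (Σ Seq λ a → Σ Seq λ b → S a × S b × Dist a b d)

DMaximal : SeqSet → ℕ → Set₁
DMaximal S d = Diam S d × (∀ (T : SeqSet) → S ⊆ T → Diam T d → T ⊆ S)

Contains1Ball : SeqSet → Set
Contains1Ball S = Σ Seq λ a → ∀ b → DistLe a b 1 → S b

Shell : SeqSet → Seq → ℕ → SeqSet
Shell S w k a = S a × Dist a w k

Enumerates : SeqSet → List Seq → Set
Enumerates P xs = All P xs
                × (∀ a → P a → Any (λ x → a ≈ x) xs)
                × AllPairs (λ x y → ¬ (x ≈ y)) xs

count : Seq → List Seq → ℕ → ℕ
count w xs i = length (filter (λ a → ¬? (a i ≟ᵇ w i)) xs)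

prob : Seq → (xs : List Seq) → .{{NonZero (length xs)}} → ℕ → ℚ
prob w xs i = (+ count w xs i) / length xs

sumBelow : ℕ → (ℕ → ℚ) → ℚ
sumBelow M f = foldr (λ i acc → f i + acc) 0ℚ (upTo M)

-- all elements of xs agree with w at every index i ≥ M; then p_i = 0
-- for i ≥ M, so Σ_{i ≥ 0} p_i = Σ_{i < M} p_i.
SupportBelow : Seq → List Seq → ℕ → Set
SupportBelow w xs M = All (λ a → ∀ i → M ≤ i → a i ≡ w i) xs

{-# OPTIONS --safe #-}
-- Let A_a be the set of coordinates where a differs from w and n = |S_k|, so that |A_a| = k
-- and n p_i counts the a ∈ S_k with i ∈ A_a. Double counting gives n Σ p_i = Σ_a |A_a| = n k
-- and n² Σ p_i² = Σ_{a,b} |A_a ∩ A_b|. For a, b ∈ S_k, |A_a| + |A_b| = |A_a △ A_b| + 2|A_a ∩ A_b|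
-- and |A_a △ A_b| = dist(a,b) ≤ d, so every |A_a ∩ A_b| is at least k − d/2.
module Submission where

open import Algebra.Bundles using (CommutativeSemiring)
open import Data.List using (List; []; _∷_; foldr; length; filter; upTo)
open import Data.List.Relation.Unary.All as All using (All; []; _∷_)

module ListSum {c ℓ} (R : CommutativeSemiring c ℓ) where

  open CommutativeSemiring R renaming (_≈_ to _≃_)
  open import Algebra.Properties.CommutativeSemigroup +-commutativeSemigroup using (interchange)

  module _ {a} {A : Set a} where

    -- the fold of Defs.sumBelow, so that sumBelow M f is ∑ (upTo M) f by definition
    ∑ : List A → (A → Carrier) → Carrier
    ∑ xs f = foldr (λ x acc → f x + acc) 0# xs

    ∑-cong : ∀ {xs f g} → All (λ x → f x ≃ g x) xs → ∑ xs f ≃ ∑ xs g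
    ∑-cong []       = refl
    ∑-cong (e ∷ es) = +-cong e (∑-cong es)

    ∑-zero : ∀ xs → ∑ xs (λ _ → 0#) ≃ 0#
    ∑-zero []       = refl
    ∑-zero (x ∷ xs) = trans (+-identityˡ _) (∑-zero xs)

    ∑-distrib-+ : ∀ xs f g → ∑ xs (λ x → f x + g x) ≃ ∑ xs f + ∑ xs g
    ∑-distrib-+ []       f g = sym (+-identityˡ 0#)
    ∑-distrib-+ (x ∷ xs) f g =
      trans (+-congˡ (∑-distrib-+ xs f g)) (interchange (f x) (g x) (∑ xs f) (∑ xs g))

    *-distribˡ-∑ : ∀ r xs f → r * ∑ xs f ≃ ∑ xs (λ x → r * f x)
    *-distribˡ-∑ r []       f = zeroʳ r
    *-distribˡ-∑ r (x ∷ xs) f = trans (distribˡ r (f x) (∑ xs f)) (+-congˡ (*-distribˡ-∑ r xs f))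

    *-distribʳ-∑ : ∀ r xs f → ∑ xs f * r ≃ ∑ xs (λ x → f x * r)
    *-distribʳ-∑ r []       f = zeroˡ r
    *-distribʳ-∑ r (x ∷ xs) f = trans (distribʳ r (f x) (∑ xs f)) (+-congˡ (*-distribʳ-∑ r xs f))

  ∑-comm : ∀ {a b} {A : Set a} {B : Set b} xs ys (h : A → B → Carrier) →
           ∑ xs (λ x → ∑ ys (h x)) ≃ ∑ ys (λ y → ∑ xs (λ x → h x y))
  ∑-comm []       ys h = sym (∑-zero ys)
  ∑-comm (x ∷ xs) ys h = trans (+-congˡ (∑-comm xs ys h)) (sym (∑-distrib-+ ys (h x) _))

  ∑-*-∑ : ∀ {a b} {A : Set a} {B : Set b} xs ys (f : A → Carrier) (g : B → Carrier) →
          ∑ xs f * ∑ ys g ≃ ∑ xs (λ x → ∑ ys (λ y → f x * g y))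
  ∑-*-∑ xs ys f g =
    trans (*-distribʳ-∑ (∑ ys g) xs f) (∑-cong (All.universal (λ x → *-distribˡ-∑ (f x) ys g) xs))

module Counting where

  open import Data.Nat using (ℕ; suc; _+_; _*_; _≤_; _<_; _≟_; _≤?_)
  open import Data.Nat.Properties
  open import Data.Bool using (Bool; true; false; if_then_else_)
  open import Data.Bool.Properties using () renaming (_≟_ to _≟ᵇ_)
  open import Data.List.Relation.Unary.Unique.Propositional using (Unique)
  open import Data.List.Relation.Unary.Unique.Propositional.Properties using (upTo⁺; Unique[x∷xs]⇒x∉xs)
  open import Data.List.Relation.Unary.AllPairs using ([]; _∷_)
  open import Data.List.Relation.Unary.Any using (here; there)
  open import Data.List.Membership.Propositional using (_∈_)
  open import Data.List.Membership.Propositional.Properties using (∈-upTo⁺)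
  open import Data.Product using (_,_)
  open import Function.Base using (_∘_)
  open import Function.Bundles using (_⇔_; mk⇔; Equivalence)
  open import Relation.Nullary using (Dec; yes; no; does; ¬_; ¬?; contradiction)
  open import Relation.Unary using (Pred; Decidable)
  open import Relation.Binary.Definitions using (DecidableEquality)
  open import Relation.Binary.PropositionalEquality
  open import Defs using (Seq; Dist; DistLe; count)

  open ListSum +-*-commutativeSemiring public

  ∑-const : ∀ {a} {A : Set a} (xs : List A) c → ∑ xs (λ _ → c) ≡ length xs * c
  ∑-const []       c = refl
  ∑-const (x ∷ xs) c = cong (c +_) (∑-const xs c)

  ∑-mono-≤ : ∀ {a} {A : Set a} {xs : List A} {f g} → All (λ x → f x ≤ g x) xs → ∑ xs f ≤ ∑ xs g
  ∑-mono-≤ []       = ≤-refl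
  ∑-mono-≤ (e ∷ es) = +-mono-≤ e (∑-mono-≤ es)

  𝟙 : ∀ {p} {P : Set p} → Dec P → ℕ
  𝟙 P? = if does P? then 1 else 0

  module _ {p} {P : Set p} where

    𝟙-yes : P → (P? : Dec P) → 𝟙 P? ≡ 1
    𝟙-yes _  (yes _) = refl
    𝟙-yes pf (no ¬p) = contradiction pf ¬p

    𝟙-no : ¬ P → (P? : Dec P) → 𝟙 P? ≡ 0
    𝟙-no ¬p (yes pf) = contradiction pf ¬p
    𝟙-no _  (no _)   = refl

  𝟙-cong : ∀ {p q} {P : Set p} {Q : Set q} → P ⇔ Q → (P? : Dec P) (Q? : Dec Q) → 𝟙 P? ≡ 𝟙 Q?
  𝟙-cong P⇔Q (yes pf) Q? = sym (𝟙-yes (Equivalence.to P⇔Q pf) Q?)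
  𝟙-cong P⇔Q (no ¬p)  Q? = sym (𝟙-no (λ q → ¬p (Equivalence.from P⇔Q q)) Q?)

  length-filter≡∑ : ∀ {a p} {A : Set a} {P : Pred A p} (P? : Decidable P) xs →
                  length (filter P? xs) ≡ ∑ xs (λ x → 𝟙 (P? x))
  length-filter≡∑ P? []       = refl
  length-filter≡∑ P? (x ∷ xs) with does (P? x)
  ... | true  = cong suc (length-filter≡∑ P? xs)
  ... | false = length-filter≡∑ P? xs

  module _ {a} {A : Set a} (_≟ᴬ_ : DecidableEquality A) where

    open import Data.List.Membership.DecPropositional _≟ᴬ_ using (_∈?_)

    ∑-𝟙-≟ : ∀ {xs} → Unique xs → ∀ y → ∑ xs (λ x → 𝟙 (x ≟ᴬ y)) ≡ 𝟙 (y ∈? xs)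
    ∑-𝟙-≟ []                    y = refl
    ∑-𝟙-≟ {x ∷ xs} u@(_ ∷ uxs) y with x ≟ᴬ y
    ... | yes refl = begin
      suc (∑ xs (λ z → 𝟙 (z ≟ᴬ x)))  ≡⟨ cong suc (∑-𝟙-≟ uxs x) ⟩
      suc (𝟙 (x ∈? xs))              ≡⟨ cong suc (𝟙-no (Unique[x∷xs]⇒x∉xs u) (x ∈? xs)) ⟩
      1                              ≡⟨ 𝟙-yes (here refl) (x ∈? (x ∷ xs)) ⟨
      𝟙 (x ∈? (x ∷ xs))              ∎
      where open ≡-Reasoning
    ... | no x≢y = trans (∑-𝟙-≟ uxs y) (𝟙-cong (mk⇔ there y∈xs) (y ∈? xs) (y ∈? (x ∷ xs)))
      where
      y∈xs : y ∈ (x ∷ xs) → y ∈ xs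
      y∈xs (here y≡x) = contradiction (sym y≡x) x≢y
      y∈xs (there y∈) = y∈

    ∑-𝟙-∈ : ∀ {xs ys} → Unique xs → Unique ys → All (_∈ ys) xs →
            ∑ ys (λ y → 𝟙 (y ∈? xs)) ≡ length xs
    ∑-𝟙-∈ {xs} {ys} uxs uys xs⊆ys = begin
      ∑ ys (λ y → 𝟙 (y ∈? xs))                  ≡⟨ ∑-cong (All.universal (λ y → sym (∑-𝟙-≟ uxs y)) ys) ⟩
      ∑ ys (λ y → ∑ xs (λ x → 𝟙 (x ≟ᴬ y)))      ≡⟨ ∑-comm ys xs _ ⟩
      ∑ xs (λ x → ∑ ys (λ y → 𝟙 (x ≟ᴬ y)))      ≡⟨ ∑-cong (All.map counted-once xs⊆ys) ⟩
      ∑ xs (λ _ → 1)                            ≡⟨ ∑-const xs 1 ⟩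
      length xs * 1                             ≡⟨ *-identityʳ (length xs) ⟩
      length xs                                 ∎
      where
      open ≡-Reasoning
      ≡-sym : ∀ {x y} → x ≡ y ⇔ y ≡ x
      ≡-sym = mk⇔ sym sym
      counted-once : ∀ {x} → x ∈ ys → ∑ ys (λ y → 𝟙 (x ≟ᴬ y)) ≡ 1
      counted-once {x} x∈ys = begin
        ∑ ys (λ y → 𝟙 (x ≟ᴬ y))  ≡⟨ ∑-cong (All.universal (λ y → 𝟙-cong ≡-sym (x ≟ᴬ y) (y ≟ᴬ x)) ys) ⟩
        ∑ ys (λ y → 𝟙 (y ≟ᴬ x))  ≡⟨ ∑-𝟙-≟ uys x ⟩
        𝟙 (x ∈? ys)              ≡⟨ 𝟙-yes x∈ys (x ∈? ys) ⟩
        1                        ∎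

  mismatch : Bool → Bool → ℕ
  mismatch x y = 𝟙 (¬? (x ≟ᵇ y))

  mismatch-+-mismatch : ∀ x y z →
    mismatch x z + mismatch y z ≡ mismatch x y + 2 * (mismatch x z * mismatch y z)
  mismatch-+-mismatch false false false = refl
  mismatch-+-mismatch false false true  = refl
  mismatch-+-mismatch false true  false = refl
  mismatch-+-mismatch false true  true  = refl
  mismatch-+-mismatch true  false false = refl
  mismatch-+-mismatch true  false true  = refl
  mismatch-+-mismatch true  true  false = refl
  mismatch-+-mismatch true  true  true  = refl

  mismatchAt : Seq → Seq → ℕ → ℕ
  mismatchAt a b i = mismatch (a i) (b i)

  ∑-mismatchAt≡Dist : ∀ {a b n} M → Dist a b n → (∀ i → M ≤ i → a i ≡ b i) →
                      ∑ (upTo M) (mismatchAt a b) ≡ n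
  ∑-mismatchAt≡Dist {a} {b} M (is , uis , refl , differ⇔∈) agree = begin
    ∑ (upTo M) (mismatchAt a b)
      ≡⟨ ∑-cong (All.universal (λ i → 𝟙-cong (differ⇔∈ i) (¬? (a i ≟ᵇ b i)) (i ∈? is)) (upTo M)) ⟩
    ∑ (upTo M) (λ i → 𝟙 (i ∈? is))
      ≡⟨ ∑-𝟙-∈ _≟_ uis (upTo⁺ M) (All.tabulate (∈-upTo⁺ ∘ below-M)) ⟩
    length is
      ∎
    where
    open ≡-Reasoning
    open import Data.List.Membership.DecPropositional _≟_ using (_∈?_)
    below-M : ∀ {i} → i ∈ is → i < M
    below-M {i} i∈is with M ≤? i
    ... | yes M≤i = contradiction (agree i M≤i) (Equivalence.from (differ⇔∈ i) i∈is)
    ... | no  M≰i = ≰⇒> M≰i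

  ∑-mismatchAt≤DistLe : ∀ {a b m} M → DistLe a b m → (∀ i → M ≤ i → a i ≡ b i) →
                        ∑ (upTo M) (mismatchAt a b) ≤ m
  ∑-mismatchAt≤DistLe M (n , dist , n≤m) agree = subst (_≤ _) (sym (∑-mismatchAt≡Dist M dist agree)) n≤m

  module _ (is : List ℕ) where

    commonMismatches : Seq → Seq → Seq → ℕ
    commonMismatches a b w = ∑ is (λ i → mismatchAt a w i * mismatchAt b w i)

    ∑-mismatchAt-+ : ∀ a b w →
      ∑ is (mismatchAt a w) + ∑ is (mismatchAt b w) ≡ ∑ is (mismatchAt a b) + 2 * commonMismatches a b w
    ∑-mismatchAt-+ a b w = begin
      ∑ is (mismatchAt a w) + ∑ is (mismatchAt b w)
        ≡⟨ ∑-distrib-+ is _ _ ⟨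
      ∑ is (λ i → mismatchAt a w i + mismatchAt b w i)
        ≡⟨ ∑-cong (All.universal (λ i → mismatch-+-mismatch (a i) (b i) (w i)) is) ⟩
      ∑ is (λ i → mismatchAt a b i + 2 * (mismatchAt a w i * mismatchAt b w i))
        ≡⟨ ∑-distrib-+ is _ _ ⟩
      ∑ is (mismatchAt a b) + ∑ is (λ i → 2 * (mismatchAt a w i * mismatchAt b w i))
        ≡⟨ cong (∑ is (mismatchAt a b) +_) (*-distribˡ-∑ 2 is _) ⟨
      ∑ is (mismatchAt a b) + 2 * commonMismatches a b w
        ∎
      where open ≡-Reasoning

    commonMismatches-≥ : ∀ a b w {k d} → ∑ is (mismatchAt a w) ≡ k → ∑ is (mismatchAt b w) ≡ k →
                         ∑ is (mismatchAt a b) ≤ d → 2 * k ≤ d + 2 * commonMismatches a b w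
    commonMismatches-≥ a b w {k} {d} aw≡k bw≡k ab≤d = begin
      2 * k                                              ≡⟨ cong (k +_) (+-identityʳ k) ⟩
      k + k                                              ≡⟨ cong₂ _+_ aw≡k bw≡k ⟨
      ∑ is (mismatchAt a w) + ∑ is (mismatchAt b w)      ≡⟨ ∑-mismatchAt-+ a b w ⟩
      ∑ is (mismatchAt a b) + 2 * commonMismatches a b w ≤⟨ +-monoˡ-≤ (2 * commonMismatches a b w) ab≤d ⟩
      d + 2 * commonMismatches a b w                     ∎
      where open ≤-Reasoning

  module _ (w : Seq) (xs : List Seq) (is : List ℕ) where

    count≡∑ : ∀ i → count w xs i ≡ ∑ xs (λ a → mismatchAt a w i)
    count≡∑ i = length-filter≡∑ (λ a → ¬? (a i ≟ᵇ w i)) xs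

    ∑-count : ∑ is (count w xs) ≡ ∑ xs (λ a → ∑ is (mismatchAt a w))
    ∑-count = trans (∑-cong (All.universal count≡∑ is)) (∑-comm is xs _)

    ∑-count² : ∑ is (λ i → count w xs i * count w xs i)
               ≡ ∑ xs (λ a → ∑ xs (λ b → commonMismatches is a b w))
    ∑-count² = begin
      ∑ is (λ i → count w xs i * count w xs i)
        ≡⟨ ∑-cong (All.universal (λ i → cong₂ _*_ (count≡∑ i) (count≡∑ i)) is) ⟩
      ∑ is (λ i → ∑ xs (λ a → mismatchAt a w i) * ∑ xs (λ b → mismatchAt b w i))
        ≡⟨ ∑-cong (All.universal (λ i → ∑-*-∑ xs xs _ _) is) ⟩
      ∑ is (λ i → ∑ xs (λ a → ∑ xs (λ b → mismatchAt a w i * mismatchAt b w i)))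
        ≡⟨ ∑-comm is xs _ ⟩
      ∑ xs (λ a → ∑ is (λ i → ∑ xs (λ b → mismatchAt a w i * mismatchAt b w i)))
        ≡⟨ ∑-cong (All.universal (λ a → ∑-comm is xs _) xs) ⟩
      ∑ xs (λ a → ∑ xs (λ b → ∑ is (λ i → mismatchAt a w i * mismatchAt b w i)))
        ∎
      where open ≡-Reasoning

    module _ {k : ℕ} (mismatches≡k : All (λ a → ∑ is (mismatchAt a w) ≡ k) xs) where

      ∑-count≡ : ∑ is (count w xs) ≡ length xs * k
      ∑-count≡ = trans ∑-count (trans (∑-cong mismatches≡k) (∑-const xs k))

      ∑-count²-≥ : ∀ {d} → All (λ a → All (λ b → ∑ is (mismatchAt a b) ≤ d) xs) xs →
                   length xs * (length xs * (2 * k))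
                     ≤ length xs * (length xs * d) + 2 * ∑ is (λ i → count w xs i * count w xs i)
      ∑-count²-≥ {d} dists≤d = begin
        n * (n * (2 * k))
          ≡⟨ ∑∑-const (2 * k) ⟨
        ∑ xs (λ a → ∑ xs (λ b → 2 * k))
          ≤⟨ ∑-mono-≤ (All.zipWith (λ {a} (a≡k , a≤d) → ∑-mono-≤ (pair-bounds {a} a≡k a≤d))
                                   (mismatches≡k , dists≤d)) ⟩
        ∑ xs (λ a → ∑ xs (λ b → d + 2 * C a b))
          ≡⟨ ∑-cong (All.universal (λ a → ∑-distrib-+ xs _ _) xs) ⟩
        ∑ xs (λ a → ∑ xs (λ _ → d) + ∑ xs (λ b → 2 * C a b))
          ≡⟨ ∑-distrib-+ xs _ _ ⟩
        ∑ xs (λ _ → ∑ xs (λ _ → d)) + ∑ xs (λ a → ∑ xs (λ b → 2 * C a b))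
          ≡⟨ cong₂ _+_ (∑∑-const d) (sym 2-out) ⟩
        n * (n * d) + 2 * ∑ xs (λ a → ∑ xs (C a))
          ≡⟨ cong (λ t → n * (n * d) + 2 * t) ∑-count² ⟨
        n * (n * d) + 2 * ∑ is (λ i → count w xs i * count w xs i)
          ∎
        where
        open ≤-Reasoning
        n = length xs
        C : Seq → Seq → ℕ
        C a b = commonMismatches is a b w
        pair-bounds : ∀ {a} → ∑ is (mismatchAt a w) ≡ k → All (λ b → ∑ is (mismatchAt a b) ≤ d) xs →
                      All (λ b → 2 * k ≤ d + 2 * C a b) xs
        pair-bounds {a} a≡k a≤d =
          All.zipWith (λ {b} (b≡k , ab≤d) → commonMismatches-≥ is a b w a≡k b≡k ab≤d) (mismatches≡k , a≤d)
        ∑∑-const : ∀ c → ∑ xs (λ _ → ∑ xs (λ _ → c)) ≡ n * (n * c)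
        ∑∑-const c = trans (∑-cong (All.universal (λ _ → ∑-const xs c) xs)) (∑-const xs (n * c))
        2-out : 2 * ∑ xs (λ a → ∑ xs (C a)) ≡ ∑ xs (λ a → ∑ xs (λ b → 2 * C a b))
        2-out = trans (*-distribˡ-∑ 2 xs _) (∑-cong (All.universal (λ a → *-distribˡ-∑ 2 xs (C a)) xs))

module Fractions where

  open import Algebra.Bundles using (CommutativeRing)
  open import Data.Nat as ℕ using (ℕ; suc; NonZero)
  import Data.Nat.Properties as ℕ
  open import Data.Integer as ℤ using (+_)
  import Data.Integer.Properties as ℤ
  open import Data.Rational using (ℚ; 1ℚ; ½; _+_; _-_; -_; _*_; _/_; _≤_; toℚᵘ; NonNegative)
  open import Data.Rational.Properties
  open import Data.Rational.Unnormalised as ℚᵘ using (mkℚᵘ; *≡*; *≤*) renaming (_≃_ to _≃ᵘ_)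
  import Data.Rational.Unnormalised.Properties as ℚᵘ
  open import Data.Rational.Solver using (module +-*-Solver)
  open import Algebra.Properties.AbelianGroup +-0-abelianGroup using (xyx⁻¹≈y)
  open import Algebra.Properties.CommutativeSemigroup (CommutativeRing.*-commutativeSemigroup +-*-commutativeRing)
    using (interchange)
  open import Relation.Binary.PropositionalEquality
  open Counting using (∑)

  module Q = ListSum (CommutativeRing.commutativeSemiring +-*-commutativeRing)

  fromℕ : ℕ → ℚ
  fromℕ n = + n / 1

  -- Equations between rationals are checked on unnormalised representatives,
  -- where + c / suc m is just mkℚᵘ (+ c) m.
  private
    toℚᵘ-/ : ∀ c n .{{_ : NonZero n}} → toℚᵘ (+ c / n) ≃ᵘ mkℚᵘ (+ c) (ℕ.pred n)
    toℚᵘ-/ c (suc m) = toℚᵘ-fromℚᵘ (mkℚᵘ (+ c) m)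

  fromℕ-+ : ∀ m n → fromℕ (m ℕ.+ n) ≡ fromℕ m + fromℕ n
  fromℕ-+ m n = toℚᵘ-injective (begin
    toℚᵘ (fromℕ (m ℕ.+ n))               ≈⟨ toℚᵘ-/ (m ℕ.+ n) 1 ⟩
    mkℚᵘ (+ (m ℕ.+ n)) 0                 ≈⟨ *≡* (cong (ℤ._* + 1) numerator) ⟩
    mkℚᵘ (+ m) 0 ℚᵘ.+ mkℚᵘ (+ n) 0       ≈⟨ ℚᵘ.+-cong (toℚᵘ-/ m 1) (toℚᵘ-/ n 1) ⟨
    toℚᵘ (fromℕ m) ℚᵘ.+ toℚᵘ (fromℕ n)   ≈⟨ toℚᵘ-homo-+ (fromℕ m) (fromℕ n) ⟨
    toℚᵘ (fromℕ m + fromℕ n)             ∎)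
    where
    open ℚᵘ.≃-Reasoning
    numerator : + (m ℕ.+ n) ≡ + m ℤ.* + 1 ℤ.+ + n ℤ.* + 1
    numerator = trans (ℤ.pos-+ m n) (sym (cong₂ ℤ._+_ (ℤ.*-identityʳ (+ m)) (ℤ.*-identityʳ (+ n))))

  fromℕ-* : ∀ m n → fromℕ (m ℕ.* n) ≡ fromℕ m * fromℕ n
  fromℕ-* m n = toℚᵘ-injective (begin
    toℚᵘ (fromℕ (m ℕ.* n))               ≈⟨ toℚᵘ-/ (m ℕ.* n) 1 ⟩
    mkℚᵘ (+ (m ℕ.* n)) 0                 ≈⟨ *≡* (cong (ℤ._* + 1) (ℤ.pos-* m n)) ⟩
    mkℚᵘ (+ m) 0 ℚᵘ.* mkℚᵘ (+ n) 0       ≈⟨ ℚᵘ.*-cong (toℚᵘ-/ m 1) (toℚᵘ-/ n 1) ⟨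
    toℚᵘ (fromℕ m) ℚᵘ.* toℚᵘ (fromℕ n)   ≈⟨ toℚᵘ-homo-* (fromℕ m) (fromℕ n) ⟨
    toℚᵘ (fromℕ m * fromℕ n)             ∎)
    where open ℚᵘ.≃-Reasoning

  fromℕ-mono-≤ : ∀ {m n} → m ℕ.≤ n → fromℕ m ≤ fromℕ n
  fromℕ-mono-≤ {m} {n} m≤n = toℚᵘ-cancel-≤ (begin
    toℚᵘ (fromℕ m)  ≃⟨ toℚᵘ-/ m 1 ⟩
    mkℚᵘ (+ m) 0    ≤⟨ *≤* (ℤ.*-monoʳ-≤-nonNeg (+ 1) (ℤ.+≤+ m≤n)) ⟩
    mkℚᵘ (+ n) 0    ≃⟨ toℚᵘ-/ n 1 ⟨
    toℚᵘ (fromℕ n)  ∎)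
    where open ℚᵘ.≤-Reasoning

  /-as-* : ∀ c n .{{_ : NonZero n}} → + c / n ≡ fromℕ c * (+ 1 / n)
  /-as-* c n@(suc m) = toℚᵘ-injective (begin
    toℚᵘ (+ c / n)                       ≈⟨ toℚᵘ-/ c n ⟩
    mkℚᵘ (+ c) m                         ≈⟨ *≡* cross ⟩
    mkℚᵘ (+ c) 0 ℚᵘ.* mkℚᵘ (+ 1) m       ≈⟨ ℚᵘ.*-cong (toℚᵘ-/ c 1) (toℚᵘ-/ 1 n) ⟨
    toℚᵘ (fromℕ c) ℚᵘ.* toℚᵘ (+ 1 / n)   ≈⟨ toℚᵘ-homo-* (fromℕ c) (+ 1 / n) ⟨
    toℚᵘ (fromℕ c * (+ 1 / n))           ∎)
    where
    open ℚᵘ.≃-Reasoning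
    cross : + c ℤ.* + (1 ℕ.* n) ≡ + c ℤ.* + 1 ℤ.* + n
    cross = trans (cong (λ x → + c ℤ.* + x) (ℕ.*-identityˡ n)) (cong (ℤ._* + n) (sym (ℤ.*-identityʳ (+ c))))

  fromℕ-*-1/ : ∀ n .{{_ : NonZero n}} → fromℕ n * (+ 1 / n) ≡ 1ℚ
  fromℕ-*-1/ n@(suc m) = trans (sym (/-as-* n n)) (toℚᵘ-injective (begin
    toℚᵘ (+ n / n)  ≈⟨ toℚᵘ-/ n n ⟩
    mkℚᵘ (+ n) m    ≈⟨ *≡* (ℤ.*-comm (+ n) (+ 1)) ⟩
    toℚᵘ 1ℚ         ∎))
    where open ℚᵘ.≃-Reasoning

  ∑-fromℕ-* : ∀ {a} {A : Set a} xs (f : A → ℕ) q →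
              Q.∑ xs (λ x → fromℕ (f x) * q) ≡ fromℕ (∑ xs f) * q
  ∑-fromℕ-* []       f q = sym (*-zeroˡ q)
  ∑-fromℕ-* (x ∷ xs) f q = begin
    fromℕ (f x) * q + Q.∑ xs (λ y → fromℕ (f y) * q)  ≡⟨ cong (λ s → fromℕ (f x) * q + s) (∑-fromℕ-* xs f q) ⟩
    fromℕ (f x) * q + fromℕ (∑ xs f) * q               ≡⟨ *-distribʳ-+ q (fromℕ (f x)) (fromℕ (∑ xs f)) ⟨
    (fromℕ (f x) + fromℕ (∑ xs f)) * q                 ≡⟨ cong (_* q) (fromℕ-+ (f x) (∑ xs f)) ⟨
    fromℕ (f x ℕ.+ ∑ xs f) * q                         ∎
    where open ≡-Reasoning

  module _ {a} {A : Set a} (xs : List A) (c : A → ℕ) (n : ℕ) .{{_ : NonZero n}} where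

    private
      u : ℚ
      u = + 1 / n

    ∑-/≡ : ∀ k → ∑ xs c ≡ n ℕ.* k → Q.∑ xs (λ x → + c x / n) ≡ fromℕ k
    ∑-/≡ k ∑≡nk = begin
      Q.∑ xs (λ x → + c x / n)        ≡⟨ Q.∑-cong (All.universal (λ x → /-as-* (c x) n) xs) ⟩
      Q.∑ xs (λ x → fromℕ (c x) * u)  ≡⟨ ∑-fromℕ-* xs c u ⟩
      fromℕ (∑ xs c) * u              ≡⟨ cong (λ m → fromℕ m * u) (trans ∑≡nk (ℕ.*-comm n k)) ⟩
      fromℕ (k ℕ.* n) * u             ≡⟨ cong (_* u) (fromℕ-* k n) ⟩
      fromℕ k * fromℕ n * u           ≡⟨ *-assoc (fromℕ k) (fromℕ n) u ⟩
      fromℕ k * (fromℕ n * u)         ≡⟨ cong (fromℕ k *_) (fromℕ-*-1/ n) ⟩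
      fromℕ k * 1ℚ                    ≡⟨ *-identityʳ (fromℕ k) ⟩
      fromℕ k                         ∎
      where open ≡-Reasoning

    ∑-/²-≥ : ∀ k d →
             n ℕ.* (n ℕ.* (2 ℕ.* k)) ℕ.≤ n ℕ.* (n ℕ.* d) ℕ.+ 2 ℕ.* ∑ xs (λ x → c x ℕ.* c x) →
             fromℕ k - + d / 2 ≤ Q.∑ xs (λ x → (+ c x / n) * (+ c x / n))
    ∑-/²-≥ k d hyp = begin
      K - + d / 2                     ≡⟨ cong (λ q → K - q) (/-as-* d 2) ⟩
      K - D * ½                       ≤⟨ +-monoˡ-≤ (- (D * ½)) K≤ ⟩
      D * ½ + C * (u * u) - D * ½     ≡⟨ xyx⁻¹≈y (D * ½) (C * (u * u)) ⟩
      C * (u * u)                     ≡⟨ ∑-fromℕ-* xs (λ x → c x ℕ.* c x) (u * u) ⟨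
      Q.∑ xs (λ x → fromℕ (c x ℕ.* c x) * (u * u))  ≡⟨ Q.∑-cong (All.universal square xs) ⟨
      Q.∑ xs (λ x → (+ c x / n) * (+ c x / n))      ∎
      where
      open ≤-Reasoning
      open +-*-Solver
      ∑c² : ℕ
      ∑c² = ∑ xs (λ x → c x ℕ.* c x)
      N K D T C : ℚ
      N = fromℕ n
      K = fromℕ k
      D = fromℕ d
      T = fromℕ 2
      C = fromℕ ∑c²
      square : ∀ x → (+ c x / n) * (+ c x / n) ≡ fromℕ (c x ℕ.* c x) * (u * u)
      square x = begin-equality
        (+ c x / n) * (+ c x / n)                ≡⟨ cong₂ _*_ (/-as-* (c x) n) (/-as-* (c x) n) ⟩
        (fromℕ (c x) * u) * (fromℕ (c x) * u)    ≡⟨ interchange (fromℕ (c x)) u (fromℕ (c x)) u ⟩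
        (fromℕ (c x) * fromℕ (c x)) * (u * u)    ≡⟨ cong (_* (u * u)) (fromℕ-* (c x) (c x)) ⟨
        fromℕ (c x ℕ.* c x) * (u * u)            ∎
      hyp′ : N * (N * (T * K)) ≤ N * (N * D) + T * C
      hyp′ = subst₂ _≤_
        (trans (fromℕ-* n _) (cong (N *_) (trans (fromℕ-* n _) (cong (N *_) (fromℕ-* 2 k)))))
        (trans (fromℕ-+ (n ℕ.* (n ℕ.* d)) (2 ℕ.* ∑c²))
               (cong₂ _+_ (trans (fromℕ-* n _) (cong (N *_) (fromℕ-* n d))) (fromℕ-* 2 ∑c²)))
        (fromℕ-mono-≤ hyp)
      instance
        u≥0 : NonNegative u
        u≥0 = normalize-nonNeg 1 n
        ½≥0 : NonNegative ½
        ½≥0 = normalize-nonNeg 1 2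
        u*u≥0 : NonNegative (u * u)
        u*u≥0 = nonNeg*nonNeg⇒nonNeg u u
        u*u*½≥0 : NonNegative (u * u * ½)
        u*u*½≥0 = nonNeg*nonNeg⇒nonNeg (u * u) ½
      -- hyp′ scaled by 1/(2n²)
      K≤ : K ≤ D * ½ + C * (u * u)
      K≤ = subst₂ _≤_
        (begin-equality
          N * (N * (T * K)) * (u * u * ½)
            ≡⟨ solve 5 (λ N T K u h → N :* (N :* (T :* K)) :* (u :* u :* h) := (N :* u) :* (N :* u) :* (T :* h) :* K)
                       refl N T K u ½ ⟩
          (N * u) * (N * u) * (T * ½) * K
            ≡⟨ cong₂ (λ p q → p * p * q * K) (fromℕ-*-1/ n) (fromℕ-*-1/ 2) ⟩
          1ℚ * 1ℚ * 1ℚ * K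
            ≡⟨ *-identityˡ K ⟩
          K ∎)
        (begin-equality
          (N * (N * D) + T * C) * (u * u * ½)
            ≡⟨ solve 6 (λ N T D C u h → (N :* (N :* D) :+ T :* C) :* (u :* u :* h)
                                     := (N :* u) :* (N :* u) :* (D :* h) :+ (T :* h) :* (C :* (u :* u)))
                       refl N T D C u ½ ⟩
          (N * u) * (N * u) * (D * ½) + (T * ½) * (C * (u * u))
            ≡⟨ cong₂ (λ p q → p * p * (D * ½) + q * (C * (u * u))) (fromℕ-*-1/ n) (fromℕ-*-1/ 2) ⟩
          1ℚ * 1ℚ * (D * ½) + 1ℚ * (C * (u * u))
            ≡⟨ cong₂ _+_ (*-identityˡ (D * ½)) (*-identityˡ (C * (u * u))) ⟩
          D * ½ + C * (u * u) ∎)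
        (*-monoʳ-≤-nonNeg (u * u * ½) hyp′)

open import Defs
open import Data.Nat using (ℕ; NonZero)
import Data.Nat as ℕ
open import Data.Integer using (+_)
open import Data.Rational using (_-_; _*_; _/_; _≤_)
open import Relation.Nullary using (¬_)
open import Relation.Binary.PropositionalEquality using (_≡_; trans; sym)
open import Data.Product using (_×_; _,_)
open Counting using (∑; mismatchAt; ∑-mismatchAt≡Dist; ∑-mismatchAt≤DistLe; ∑-count≡; ∑-count²-≥)
open Fractions using (∑-/≡; ∑-/²-≥)

lemma16 : (d : ℕ) (S : SeqSet) → DMaximal S d → ¬ Contains1Ball S →
    (w : Seq) → S w → (k : ℕ) →
    (xs : List Seq) → Enumerates (Shell S w k) xs → .{{_ : NonZero (length xs)}} →
    (M : ℕ) → SupportBelow w xs M →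
    (sumBelow M (prob w xs) ≡ (+ k) / 1)
    × ((+ k) / 1 - (+ d) / 2 ≤ sumBelow M (λ i → prob w xs i * prob w xs i))
lemma16 d _ ((diam , _) , _) _ w _ k xs (inShell , _ , _) M agree =
  ∑-/≡ (upTo M) (count w xs) (length xs) k (∑-count≡ w xs (upTo M) mismatches≡k) ,
  ∑-/²-≥ (upTo M) (count w xs) (length xs) k d (∑-count²-≥ w xs (upTo M) mismatches≡k dists≤d)
  where
  mismatches≡k : All (λ a → ∑ (upTo M) (mismatchAt a w) ≡ k) xs
  mismatches≡k = All.zipWith (λ ((_ , dist-aw) , a≈w) → ∑-mismatchAt≡Dist M dist-aw a≈w) (inShell , agree)
  dists≤d : All (λ a → All (λ b → ∑ (upTo M) (mismatchAt a b) ℕ.≤ d) xs) xs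
  dists≤d = All.zipWith (λ ((Sa , _) , a≈w) →
              All.zipWith (λ ((Sb , _) , b≈w) →
                ∑-mismatchAt≤DistLe M (diam _ _ Sa Sb) (λ i M≤i → trans (a≈w i M≤i) (sym (b≈w i M≤i))))
              (inShell , agree))
            (inShell , agree)
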